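{- Among the binomial recurrences $x_nx_{n+N}=P_n^++P_n^-$ associated to period $1$ quivers, the only ones which, with nontrivial parameters allowed on both monomials (i.e. $x_nx_{n+N}=u\,P_n^++v\,P_n^-$ with $u\ne1$ and $v\ne1$), arise from period $1$ ice quivers are the two-term Gale-Robinson recurrences $x_nx_{n+N}=x_{n+N-r}x_{n+r}+x_{n+N-s}x_{n+s}$ with $0<r<s\le N/2$.
   Context: For an $N\times N$ skew-symmetric integer matrix $B$ with $\mu_1B=\rho B\rho^{ -1}$ (a period $1$ quiver), where $\mu_1$ is Fomin–Zelevinsky mutation at node $1$ and $\rho$ is the permutation matrix with $\rho_{i+1,i}=1$ ($1\le i\le N-1$), $\rho_{1,N}=1$, set $m_j=b_{j+1,1}$; the associated recurrence is $x_nx_{n+N}=P_n^++P_n^-$ with $P_n^+=\prod_{m_i>0}x_{n+i}^{m_i}$, $P_n^-=\prod_{m_i<0}x_{n+i}^{ -m_i}$. A period $1$ ice quiver is an $(N+M)\times(N+M)$ skew-symmetric matrix with zero frozen–frozen block ($M$ frozen vertices carrying parameters $y_1,\dots,y_M$) satisfying $\widetilde\mu_1B=\widetilde\rho B\widetilde\rho^{\,-1}$, where $\widetilde\mu_1$ is mutation at $1$ keeping the frozen–frozen block zero and $\widetilde\rho=\mathrm{diag}(\rho,I_M)$; successive mutation at $1,2,\dots$ with the exchange relation with coefficients $x_\ell\tilde x_\ell=\prod_{b_{N+i,\ell}>0}y_i^{b_{N+i,\ell}}\prod_{b_{i\ell}>0,\,i\le N}x_i^{b_{i\ell}}+\prod_{b_{N+i,\ell}<0}y_i^{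 -b_{N+i,\ell}}\prod_{b_{i\ell}<0,\,i\le N}x_i^{ -b_{i\ell}}$ produces a recurrence $x_nx_{n+N}=u\,P_n^++v\,P_n^-$ with monomial coefficients $u,v$ in the $y_i$. -}

module Defs where

open import Data.Nat using (ℕ; zero; suc; _≡ᵇ_; _∸_) renaming (_+_ to _+ℕ_)
open import Data.Integer using (ℤ; +_; -[1+_]; _+_; _-_; _*_; -_)
open import Data.Fin using (Fin; zero; suc; fromℕ; inject₁; splitAt; join; toℕ; _≟_; _↑ˡ_; _↑ʳ_)
open import Data.Bool using (Bool; true; false; if_then_else_; _∨_; _∧_)
open import Data.Sum using (inj₁; inj₂)
import Data.Sum as Sum
open import Relation.Nullary using (does)
open import Relation.Binary.PropositionalEquality using (_≡_)

-- Square integer matrices, indexed 0-based (vertex k of the paper is index k-1).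
Mat : ℕ → Set
Mat N = Fin N → Fin N → ℤ

SkewSym : ∀ {N} → Mat N → Set
SkewSym B = ∀ i j → B j i ≡ - B i j

pos : ℤ → ℕ
pos (+ k) = k
pos -[1+ k ] = 0

mutate : ∀ {N} → Mat N → Fin N → Mat N
mutate B k i j =
  if does (i ≟ k) ∨ does (j ≟ k)
  then - B i j
  else B i j + (+ pos (B i k)) * (+ pos (B k j)) - (+ pos (- B i k)) * (+ pos (- B k j))

-- cyclic predecessor i ↦ i-1 (mod N): this is ρ⁻¹ acting on indices,
-- since ρ e_i = e_{i+1}.  Hence (ρ B ρ⁻¹)_{ij} = B_{ρ⁻¹ i, ρ⁻¹ j}.
cycPred : ∀ {n} → Fin (suc n) → Fin (suc n)
cycPred {n} zero = fromℕ n
cycPred (suc i) = inject₁ i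

-- conjugation by a permutation matrix, given the inverse permutation on indices
conj : ∀ {N} → (Fin N → Fin N) → Mat N → Mat N
conj τ B i j = B (τ i) (τ j)

rhoConj : ∀ {n} → Mat (suc n) → Mat (suc n)
rhoConj = conj cycPred

Period1 : ∀ {n} → Mat (suc n) → Set
Period1 B = ∀ i j → mutate B zero i j ≡ rhoConj B i j

-- Ice quivers: (N+M)×(N+M), first N vertices mutable, last M frozen.

isFrozen : ∀ N {M} → Fin (N +ℕ M) → Bool
isFrozen N i with splitAt N i
... | inj₁ _ = false
... | inj₂ _ = true

mutateIce : ∀ N {M} → Mat (N +ℕ M) → Fin (N +ℕ M) → Mat (N +ℕ M)
mutateIce N B k i j =
  if isFrozen N i ∧ isFrozen N j then + 0 else mutate B k i j

rhoTildeInv : ∀ n M → Fin (suc n +ℕ M) → Fin (suc n +ℕ M)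
rhoTildeInv n M i = join (suc n) M (Sum.map₁ cycPred (splitAt (suc n) i))

IsPeriod1IceQuiver : ∀ n M → Mat (suc n +ℕ M) → Set
IsPeriod1IceQuiver n M Bt =
    SkewSym Bt
  × (∀ (i j : Fin M) → Bt (suc n ↑ʳ i) (suc n ↑ʳ j) ≡ + 0)
  × (∀ i j → mutateIce (suc n) Bt zero i j ≡ conj (rhoTildeInv n M) Bt i j)
  where open import Data.Product using (_×_)

Extends : ∀ {n M} → Mat (suc n +ℕ M) → Mat (suc n) → Set
Extends {n} {M} Bt B = ∀ i j → Bt (i ↑ˡ M) (j ↑ˡ M) ≡ B i j

-- Exponent vectors (over y_1..y_M) of the coefficients u and v in the first
-- exchange relation  x_1 x̃_1 = u·(…) + v·(…):
--   u = ∏ y_i^{[b_{N+i,1}]_+},  v = ∏ y_i^{[-b_{N+i,1}]_+}.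
-- By periodicity these are the coefficients of the whole recurrence.
uExp : ∀ {n M} → Mat (suc n +ℕ M) → Fin M → ℕ
uExp {n} Bt i = pos (Bt (suc n ↑ʳ i) zero)

vExp : ∀ {n M} → Mat (suc n +ℕ M) → Fin M → ℕ
vExp {n} Bt i = pos (- Bt (suc n ↑ʳ i) zero)

IsOne : ∀ {M} → (Fin M → ℕ) → Set
IsOne e = ∀ i → e i ≡ 0

-- The recurrence of a period 1 quiver: m_j = b_{j+1,1}, j = 1..N-1.
-- Here j : Fin n stands for j+1 ∈ {1,…,N-1} (N = suc n), so m (j) = B (suc j) zero.
-- Exponent of x_{n+j} in P⁺ and P⁻ respectively.
Pplus : ∀ {n} → Mat (suc n) → Fin n → ℕ
Pplus B j = pos (B (suc j) zero)

Pminus : ∀ {n} → Mat (suc n) → Fin n → ℕ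
Pminus B j = pos (- B (suc j) zero)

δ : ℕ → ℕ → ℕ
δ a b = if a ≡ᵇ b then 1 else 0

-- exponent vector of the monomial x_{n+N-r} x_{n+r}  (N = suc n),
-- at position j ∈ {1,…,N-1} (encoded as j : Fin n meaning toℕ j + 1)
GRmon : ∀ n → ℕ → Fin n → ℕ
GRmon n r j = δ (suc (toℕ j)) r +ℕ δ (suc (toℕ j)) (suc n ∸ r)

-- Index the vertices 0, …, n (N = n + 1) and let m_t = b_{t,0}. Periodicity of B gives
-- b_{i,j} = b_{i+1,j+1} + [m_{i+1}]₊[−m_{j+1}]₊ − [−m_{i+1}]₊[m_{j+1}]₊ and b_{n,j} = m_{j+1};
-- comparing the two ends of a diagonal of B shows that m is palindromic, m_t = m_{N−t}.
-- A frozen row (c_0, …, c_n) of a period 1 ice quiver, with head a = c_0, satisfies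
-- c_k = c_{k+1} + [a]₊[−m_{k+1}]₊ − [−a]₊[m_{k+1}]₊ and c_n = −a, and telescoping gives
-- Σ_t [−m_t]₊ = 2 if a > 0 and Σ_t [m_t]₊ = 2 if a < 0; conversely, when both sums are 2
-- every head a extends to such a row. So u ≠ 1 ≠ v is possible exactly when the positive and
-- the negative part of m are palindromic of degree 2, i.e. the exponents of x_{n+r}x_{n+N−r}
-- and x_{n+s}x_{n+N−s}, with r ≠ s since m_r has a single sign.

module Submission where

open import Defs
open import Data.Fin using (Fin; zero; suc; toℕ; fromℕ; fromℕ<; inject₁; _↑ˡ_; _↑ʳ_; splitAt; join)
open import Data.Fin.Properties as Fin using () renaming (_≟_ to _≟ᶠ_)
open import Data.Nat using (ℕ; zero; suc; _<_; _≤_; _*_; _∸_; z≤n; s≤s; _≟_; _<?_; s≤s⁻¹)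
  renaming (_+_ to _+ℕ_)
open import Data.Nat.Properties as ℕ using ()
open import Data.Integer using (ℤ; +_; -[1+_]; -_; NonZero) renaming (_+_ to _+ℤ_; _-_ to _-ℤ_; _*_ to _*ℤ_)
open import Data.Integer.Properties as ℤ using ()
open import Data.Integer.Tactic.RingSolver using (solve-∀)
import Data.Nat.Tactic.RingSolver as NS
open import Data.Product using (_×_; _,_; proj₁; proj₂; ∃-syntax)
open import Data.Sum using (_⊎_; inj₁; inj₂; [_,_]′)
open import Data.Empty using (⊥; ⊥-elim)
open import Relation.Nullary using (¬_; yes; no; does)
open import Function using (_∘′_; _⇔_; mk⇔; Equivalence)
open import Relation.Binary.PropositionalEquality
open import Data.Bool using (true; false)
import Data.Bool.Properties
open import Relation.Binary.Definitions using (tri<; tri≈; tri>)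
open import Algebra.Properties.CommutativeSemigroup ℕ.+-commutativeSemigroup using () renaming (interchange to +-interchange)

-- Finite sums

sumTo : (ℕ → ℕ) → ℕ → ℕ
sumTo e zero    = 0
sumTo e (suc k) = sumTo e k +ℕ e (suc k)

InRange : ℕ → ℕ → Set
InRange k t = 1 ≤ t × t ≤ k

InRange-weaken : ∀ {k t} → InRange k t → InRange (suc k) t
InRange-weaken (1≤t , t≤k) = 1≤t , ℕ.m≤n⇒m≤1+n t≤k

InRange-last : ∀ k → InRange (suc k) (suc k)
InRange-last k = s≤s z≤n , ℕ.≤-refl

sumTo-cong : ∀ {g h} k → (∀ t → InRange k t → g t ≡ h t) → sumTo g k ≡ sumTo h k
sumTo-cong zero    g≡h = refl
sumTo-cong (suc k) g≡h =
  cong₂ _+ℕ_ (sumTo-cong k (λ t → g≡h t ∘′ InRange-weaken)) (g≡h (suc k) (InRange-last k))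


sumTo-+ : ∀ g h k → sumTo (λ t → g t +ℕ h t) k ≡ sumTo g k +ℕ sumTo h k
sumTo-+ g h zero    = refl
sumTo-+ g h (suc k) rewrite sumTo-+ g h k = +-interchange (sumTo g k) (sumTo h k) (g (suc k)) (h (suc k))

sumTo-≡0 : ∀ {e} k → sumTo e k ≡ 0 → ∀ t → InRange k t → e t ≡ 0
sumTo-≡0 zero    _  t (1≤t , t≤0) = ⊥-elim (ℕ.<⇒≱ 1≤t t≤0)
sumTo-≡0 {e} (suc k) Σ≡0 t (1≤t , t≤1+k) with ℕ.m≤n⇒m<n∨m≡n t≤1+k
... | inj₁ t<1+k  = sumTo-≡0 k (ℕ.m+n≡0⇒m≡0 _ Σ≡0) t (1≤t , s≤s⁻¹ t<1+k)
... | inj₂ refl   = ℕ.m+n≡0⇒n≡0 (sumTo e k) Σ≡0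

sumTo-tight : ∀ {g e} k → (∀ t → InRange k t → g t ≤ e t) → sumTo e k ≡ sumTo g k →
              ∀ t → InRange k t → e t ≡ g t
sumTo-tight {g} {e} k g≤e Σe≡Σg t t∈ = begin
  e t             ≡⟨ gap t t∈ ⟨
  g t +ℕ (e t ∸ g t) ≡⟨ cong (g t +ℕ_) (sumTo-≡0 k gap≡0 t t∈) ⟩
  g t +ℕ 0        ≡⟨ ℕ.+-identityʳ (g t) ⟩
  g t             ∎
  where
  open ≡-Reasoning
  gap : ∀ t → InRange k t → g t +ℕ (e t ∸ g t) ≡ e t
  gap t t∈ = ℕ.m+[n∸m]≡n (g≤e t t∈)
  gap≡0 : sumTo (λ t → e t ∸ g t) k ≡ 0
  gap≡0 = ℕ.+-cancelˡ-≡ (sumTo g k) _ 0 (begin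
    sumTo g k +ℕ sumTo (λ t → e t ∸ g t) k ≡⟨ sumTo-+ g _ k ⟨
    sumTo (λ t → g t +ℕ (e t ∸ g t)) k    ≡⟨ sumTo-cong k gap ⟩
    sumTo e k                              ≡⟨ Σe≡Σg ⟩
    sumTo g k                              ≡⟨ ℕ.+-identityʳ _ ⟨
    sumTo g k +ℕ 0                         ∎)

sumTo-<⇒∃< : ∀ g e k → sumTo g k < sumTo e k → ∃[ t ] (InRange k t × g t < e t)
sumTo-<⇒∃< g e zero ()
sumTo-<⇒∃< g e (suc k) Σg<Σe with g (suc k) <? e (suc k) | sumTo g k <? sumTo e k
... | yes gk<ek | _         = suc k , InRange-last k , gk<ek
... | no _      | yes Σ<    = let t , t∈ , gt<et = sumTo-<⇒∃< g e k Σ< in t , InRange-weaken t∈ , gt<et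
... | no gk≮ek  | no Σ≮     = ⊥-elim (ℕ.<⇒≱ Σg<Σe (ℕ.+-mono-≤ (ℕ.≮⇒≥ Σ≮) (ℕ.≮⇒≥ gk≮ek)))

sumTo-zero : ∀ k → sumTo (λ _ → 0) k ≡ 0
sumTo-zero zero    = refl
sumTo-zero (suc k) = trans (ℕ.+-identityʳ _) (sumTo-zero k)

δ-refl : ∀ a → δ a a ≡ 1
δ-refl zero    = refl
δ-refl (suc a) = δ-refl a

δ-≢ : ∀ {a b} → a ≢ b → δ a b ≡ 0
δ-≢ {zero}  {zero}  a≢b = ⊥-elim (a≢b refl)
δ-≢ {zero}  {suc b} _   = refl
δ-≢ {suc a} {zero}  _   = refl
δ-≢ {suc a} {suc b} a≢b = δ-≢ (a≢b ∘′ cong suc)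

sumTo-δ-below : ∀ {r} k → k < r → sumTo (λ t → δ t r) k ≡ 0
sumTo-δ-below zero    _   = refl
sumTo-δ-below (suc k) k<r =
  cong₂ _+ℕ_ (sumTo-δ-below k (ℕ.<-trans (ℕ.n<1+n k) k<r)) (δ-≢ (ℕ.<⇒≢ k<r))

sumTo-δ : ∀ {r} k → 1 ≤ r → r ≤ k → sumTo (λ t → δ t r) k ≡ 1
sumTo-δ zero    1≤r r≤0 = ⊥-elim (ℕ.<⇒≱ 1≤r r≤0)
sumTo-δ (suc k) 1≤r r≤1+k with ℕ.m≤n⇒m<n∨m≡n r≤1+k
... | inj₁ r<1+k = cong₂ _+ℕ_ (sumTo-δ k 1≤r (s≤s⁻¹ r<1+k)) (δ-≢ (ℕ.>⇒≢ r<1+k))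
... | inj₂ refl  = cong₂ _+ℕ_ (sumTo-δ-below k (ℕ.n<1+n k)) (δ-refl (suc k))

-- Palindromic exponent vectors of degree 2

-- the exponent of x_{n+t} in x_{n+r} x_{n+N-r}, for 1 ≤ t ≤ n and N = suc n
grExp : ℕ → ℕ → ℕ → ℕ
grExp n r t = δ t r +ℕ δ t (suc n ∸ r)

GaleRobinson : ℕ → ℕ → (ℕ → ℕ) → Set
GaleRobinson n r e = 1 ≤ r × r +ℕ r ≤ suc n × (∀ t → InRange n t → e t ≡ grExp n r t)

Palindromic : ℕ → (ℕ → ℕ) → Set
Palindromic n e = ∀ c d → 1 ≤ c → 1 ≤ d → c +ℕ d ≡ suc n → e c ≡ e d

double≤1+n⇒≤n : ∀ {r n} → 1 ≤ r → r +ℕ r ≤ suc n → r ≤ n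
double≤1+n⇒≤n {r} 1≤r 2r≤N = s≤s⁻¹ (ℕ.≤-trans (subst (_≤ r +ℕ r) (ℕ.+-comm r 1) (ℕ.+-monoʳ-≤ r 1≤r)) 2r≤N)

sumTo-grExp : ∀ n {r} → 1 ≤ r → r +ℕ r ≤ suc n → sumTo (grExp n r) n ≡ 2
sumTo-grExp n {r} 1≤r 2r≤N = begin
  sumTo (grExp n r) n                                   ≡⟨ sumTo-+ _ _ n ⟩
  sumTo (λ t → δ t r) n +ℕ sumTo (λ t → δ t (suc n ∸ r)) n
    ≡⟨ cong₂ _+ℕ_ (sumTo-δ n 1≤r r≤n) (sumTo-δ n (ℕ.m<n⇒0<n∸m (s≤s r≤n)) (ℕ.∸-monoʳ-≤ (suc n) 1≤r)) ⟩
  2                                                     ∎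
  where
  open ≡-Reasoning
  r≤n : r ≤ n
  r≤n = double≤1+n⇒≤n 1≤r 2r≤N

double-injective : ∀ {a b} → a +ℕ a ≡ b +ℕ b → a ≡ b
double-injective {a} {b} 2a≡2b with ℕ.<-cmp a b
... | tri< a<b _ _ = ⊥-elim (ℕ.<⇒≢ (ℕ.+-mono-< a<b a<b) 2a≡2b)
... | tri≈ _ a≡b _ = a≡b
... | tri> _ _ a>b = ⊥-elim (ℕ.>⇒≢ (ℕ.+-mono-< a>b a>b) 2a≡2b)

+-∸-mirror : ∀ r {N} → r +ℕ r < N → r +ℕ (N ∸ r) ≡ N
+-∸-mirror r 2r<N = ℕ.m+[n∸m]≡n (ℕ.≤-trans (ℕ.m≤m+n r r) (ℕ.<⇒≤ 2r<N))

<-∸-mirror : ∀ r {N} → r +ℕ r < N → r < N ∸ r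
<-∸-mirror r 2r<N = ℕ.+-cancelˡ-< r r _ (subst (r +ℕ r <_) (sym (+-∸-mirror r 2r<N)) 2r<N)

grExp-at : ∀ n r → r +ℕ r < suc n → grExp n r r ≡ 1
grExp-at n r 2r<N = cong₂ _+ℕ_ (δ-refl r) (δ-≢ (ℕ.<⇒≢ (<-∸-mirror r 2r<N)))

grExp-at-mirror : ∀ n r → r +ℕ r < suc n → grExp n r (suc n ∸ r) ≡ 1
grExp-at-mirror n r 2r<N = cong₂ _+ℕ_ (δ-≢ (ℕ.>⇒≢ (<-∸-mirror r 2r<N))) (δ-refl (suc n ∸ r))

grExp-centre : ∀ n r → r +ℕ r ≡ suc n → ∀ t → grExp n r t ≡ δ t r +ℕ δ t r
grExp-centre n r 2r≡N t = cong (λ r′ → δ t r +ℕ δ t r′) (trans (cong (_∸ r) (sym 2r≡N)) (ℕ.m+n∸n≡m r r))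

grExp-elsewhere : ∀ n r {t} → t ≢ r → t ≢ suc n ∸ r → grExp n r t ≡ 0
grExp-elsewhere n _ t≢r t≢r′ = cong₂ _+ℕ_ (δ-≢ t≢r) (δ-≢ t≢r′)

module _ {n : ℕ} {e : ℕ → ℕ} (pal : Palindromic n e) (Σe≡2 : sumTo e n ≡ 2) where

  private
    fromLowerBound : ∀ {r} → 1 ≤ r → r +ℕ r ≤ suc n → (∀ t → grExp n r t ≤ e t) → GaleRobinson n r e
    fromLowerBound 1≤r 2r≤N lower =
      1≤r , 2r≤N , sumTo-tight n (λ t _ → lower t) (trans Σe≡2 (sym (sumTo-grExp n 1≤r 2r≤N)))

    lower-offCentre : ∀ {r} → 1 ≤ r → r +ℕ r < suc n → 1 ≤ e r → ∀ t → grExp n r t ≤ e t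
    lower-offCentre {r} 1≤r 2r<N 1≤er t with t ≟ r | t ≟ suc n ∸ r
    ... | yes refl | _        = ℕ.≤-trans (ℕ.≤-reflexive (grExp-at n r 2r<N)) 1≤er
    ... | no _     | yes refl = ℕ.≤-trans (ℕ.≤-reflexive (grExp-at-mirror n r 2r<N))
                                  (subst (1 ≤_) (pal r _ 1≤r 1≤r′ (+-∸-mirror r 2r<N)) 1≤er)
      where
      1≤r′ : 1 ≤ suc n ∸ r
      1≤r′ = ℕ.<-≤-trans 1≤r (ℕ.<⇒≤ (<-∸-mirror r 2r<N))
    ... | no t≢r   | no t≢r′  = subst (_≤ e t) (sym (grExp-elsewhere n r t≢r t≢r′)) z≤n

    lower-centre : ∀ {r} → r +ℕ r ≡ suc n → 2 ≤ e r → ∀ t → grExp n r t ≤ e t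
    lower-centre {r} 2r≡N 2≤er t with t ≟ r
    ... | yes refl = subst (_≤ e t) (sym (trans (grExp-centre n t 2r≡N t) (cong (λ x → x +ℕ x) (δ-refl t)))) 2≤er
    ... | no t≢r   = subst (_≤ e t) (sym (trans (grExp-centre n r 2r≡N t) (cong (λ x → x +ℕ x) (δ-≢ t≢r)))) z≤n

    offCentre : ∀ {u} → InRange n u → 1 ≤ e u → u +ℕ u ≢ suc n → ∃[ r ] GaleRobinson n r e
    offCentre {u} (1≤u , u≤n) 1≤eu 2u≢N with ℕ.<-cmp (u +ℕ u) (suc n)
    ... | tri< 2u<N _ _ = u , fromLowerBound 1≤u (ℕ.<⇒≤ 2u<N) (lower-offCentre 1≤u 2u<N 1≤eu)
    ... | tri≈ _ 2u≡N _ = ⊥-elim (2u≢N 2u≡N)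
    ... | tri> _ _ 2u>N = r , fromLowerBound 1≤r (ℕ.<⇒≤ 2r<N) (lower-offCentre 1≤r 2r<N (subst (1 ≤_) (pal u r 1≤u 1≤r u+r≡N) 1≤eu))
      where
      r = suc n ∸ u
      u+r≡N : u +ℕ r ≡ suc n
      u+r≡N = ℕ.m+[n∸m]≡n (ℕ.m≤n⇒m≤1+n u≤n)
      1≤r : 1 ≤ r
      1≤r = ℕ.m<n⇒0<n∸m (s≤s u≤n)
      2r<N : r +ℕ r < suc n
      2r<N = subst (r +ℕ r <_) u+r≡N (ℕ.+-monoˡ-< r (ℕ.+-cancelˡ-< u r u (subst (_< u +ℕ u) (sym u+r≡N) 2u>N)))

  palindromic-galeRobinson : ∃[ r ] GaleRobinson n r e
  palindromic-galeRobinson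
    with sumTo-<⇒∃< (λ _ → 0) e n (subst₂ _<_ (sym (sumTo-zero n)) (sym Σe≡2) (s≤s z≤n))
  ... | t , t∈ , 1≤et with t +ℕ t ≟ suc n
  ...   | no 2t≢N  = offCentre t∈ 1≤et 2t≢N
  ...   | yes 2t≡N
    with sumTo-<⇒∃< (λ u → δ u t) e n (subst₂ _<_ (sym (sumTo-δ n (proj₁ t∈) (proj₂ t∈))) (sym Σe≡2) ℕ.≤-refl)
  ...     | u , u∈ , δut<eu with u ≟ t
  ...       | yes refl = u , fromLowerBound (proj₁ t∈) (ℕ.≤-reflexive 2t≡N)
                               (lower-centre 2t≡N (subst (_< e u) (δ-refl u) δut<eu))
  ...       | no u≢t   = offCentre u∈ (subst (_< e u) (δ-≢ u≢t) δut<eu) (λ 2u≡N → u≢t (double-injective (trans 2u≡N (sym 2t≡N))))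

-- Palindromy of period 1 quivers

fzTerm : ℤ → ℤ → ℤ
fzTerm x y = + pos x *ℤ + pos y -ℤ + pos (- x) *ℤ + pos (- y)

fzTerm-antisym : ∀ x y → fzTerm y (- x) ≡ - fzTerm x (- y)
fzTerm-antisym x y rewrite ℤ.neg-involutive x | ℤ.neg-involutive y =
  swap (+ pos x) (+ pos (- x)) (+ pos y) (+ pos (- y))
  where
  swap : ∀ px nx py ny → py *ℤ nx -ℤ ny *ℤ px ≡ - (px *ℤ ny -ℤ nx *ℤ py)
  swap = solve-∀

≡-neg⇒≡0 : ∀ {d} → d ≡ - d → d ≡ + 0
≡-neg⇒≡0 {+ zero}   _ = refl
≡-neg⇒≡0 {+ suc _}  ()
≡-neg⇒≡0 { -[1+ _ ]} ()

i-j≡j-i⇒i≡j : ∀ i j → i -ℤ j ≡ j -ℤ i → i ≡ j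
i-j≡j-i⇒i≡j i j eq = ℤ.i-j≡0⇒i≡j i j (≡-neg⇒≡0 (trans eq (flipDiff i j)))
  where
  flipDiff : ∀ i j → j -ℤ i ≡ - (i -ℤ j)
  flipDiff = solve-∀

module ShiftPalindrome (n : ℕ) (b : ℕ → ℕ → ℤ)
  (shift   : ∀ {i j} → i < n → j < n → b i j ≡ b (suc i) (suc j) +ℤ fzTerm (b (suc i) 0) (- b (suc j) 0))
  (lastRow : ∀ {j} → j < n → b n j ≡ b (suc j) 0) where

  column : ℕ → ℤ
  column t = b t 0

  PalindromicUpTo : ℕ → Set
  PalindromicUpTo k = ∀ c d → c ≤ k → 1 ≤ c → 1 ≤ d → c +ℕ d ≡ suc n → column c ≡ column d

  -- With k + l = n, the diagonal b (l + q) q runs from column l to column (k + 1); its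
  -- increments at q and at k - 1 - q cancel by the induction hypothesis and fzTerm-antisym.
  palindromic-step : ∀ k l → PalindromicUpTo k → 1 ≤ l → k +ℕ l ≡ n → column (suc k) ≡ column l
  palindromic-step k l ih 1≤l k+l≡n = begin
    column (suc k) ≡⟨ lastRow k<n ⟨
    b n k          ≡⟨ cong (λ i → b i k) l+k≡n ⟨
    diagonal k     ≡⟨ i-j≡j-i⇒i≡j (diagonal k) (diagonal 0) (pairing k 0 (ℕ.+-identityʳ k)) ⟩
    diagonal 0     ≡⟨ cong (λ i → b i 0) (ℕ.+-identityʳ l) ⟩
    column l       ∎
    where
    open ≡-Reasoning
    l+k≡n : l +ℕ k ≡ n
    l+k≡n = trans (ℕ.+-comm l k) k+l≡n
    k<n : k < n
    k<n = subst (k <_) k+l≡n (ℕ.m<m+n k 1≤l)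

    diagonal : ℕ → ℤ
    diagonal q = b (l +ℕ q) q

    diagonal-step : ∀ {q} → q < k → diagonal q ≡ diagonal (suc q) +ℤ fzTerm (column (suc (l +ℕ q))) (- column (suc q))
    diagonal-step {q} q<k = subst (λ i → diagonal q ≡ b i (suc q) +ℤ fzTerm (column (suc (l +ℕ q))) (- column (suc q))) (sym (ℕ.+-suc l q))
      (shift (subst (l +ℕ q <_) l+k≡n (ℕ.+-monoʳ-< l q<k)) (ℕ.<-≤-trans q<k (subst (k ≤_) k+l≡n (ℕ.m≤m+n k l))))

    mirror : ∀ q p → q +ℕ suc p ≡ k → column (suc (l +ℕ q)) ≡ column (suc p)
    mirror q p q+1+p≡k = sym (ih (suc p) (suc (l +ℕ q)) (subst (suc p ≤_) q+1+p≡k (ℕ.m≤n+m (suc p) q)) (s≤s z≤n) (s≤s z≤n)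
      (trans (reorder p q l) (cong suc (trans (cong (l +ℕ_) q+1+p≡k) l+k≡n))))
      where
      reorder : ∀ p q l → suc p +ℕ suc (l +ℕ q) ≡ suc (l +ℕ (q +ℕ suc p))
      reorder = NS.solve-∀

    pairing : ∀ q p → q +ℕ p ≡ k → diagonal q -ℤ diagonal p ≡ diagonal 0 -ℤ diagonal k
    pairing zero    p refl = refl
    pairing (suc q) p q+1+p≡k = begin
      diagonal (suc q) -ℤ diagonal p                            ≡⟨ cong (λ x → diagonal (suc q) -ℤ x) stepP ⟩
      diagonal (suc q) -ℤ (diagonal (suc p) -ℤ F)               ≡⟨ regroup (diagonal (suc q)) (diagonal (suc p)) F ⟩
      (diagonal (suc q) +ℤ F) -ℤ diagonal (suc p)               ≡⟨ cong (_-ℤ diagonal (suc p)) stepQ ⟨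
      diagonal q -ℤ diagonal (suc p)                            ≡⟨ pairing q (suc p) (trans (ℕ.+-suc q p) q+1+p≡k) ⟩
      diagonal 0 -ℤ diagonal k                                  ∎
      where
      F : ℤ
      F = fzTerm (column (suc p)) (- column (suc q))
      p+1+q≡k : p +ℕ suc q ≡ k
      p+1+q≡k = trans (ℕ.+-comm p (suc q)) q+1+p≡k
      stepQ : diagonal q ≡ diagonal (suc q) +ℤ F
      stepQ = trans (diagonal-step (subst (q <_) q+1+p≡k (ℕ.m≤m+n (suc q) p)))
                    (cong (λ x → diagonal (suc q) +ℤ fzTerm x (- column (suc q))) (mirror q p (trans (ℕ.+-suc q p) q+1+p≡k)))
      stepP : diagonal p ≡ diagonal (suc p) -ℤ F
      stepP = trans (diagonal-step (subst (p <_) p+1+q≡k (ℕ.m<m+n p (s≤s z≤n))))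
                    (cong (diagonal (suc p) +ℤ_) (trans (cong (λ x → fzTerm x (- column (suc p))) (mirror p q p+1+q≡k))
                                                        (fzTerm-antisym (column (suc p)) (column (suc q)))))
      regroup : ∀ a b f → a -ℤ (b -ℤ f) ≡ (a +ℤ f) -ℤ b
      regroup = solve-∀

  palindromicUpTo : ∀ k → PalindromicUpTo k
  palindromicUpTo zero    c d c≤0 1≤c _ _ = ⊥-elim (ℕ.<⇒≱ 1≤c c≤0)
  palindromicUpTo (suc k) c d c≤1+k 1≤c 1≤d c+d≡N with ℕ.m≤n⇒m<n∨m≡n c≤1+k
  ... | inj₁ c<1+k = palindromicUpTo k c d (s≤s⁻¹ c<1+k) 1≤c 1≤d c+d≡N
  ... | inj₂ refl  = palindromic-step k d (palindromicUpTo k) 1≤d (ℕ.suc-injective c+d≡N)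

  palindromic : ∀ c d → 1 ≤ c → 1 ≤ d → c +ℕ d ≡ suc n → column c ≡ column d
  palindromic c d 1≤c 1≤d c+d≡N = palindromicUpTo (suc n) c d (ℕ.≤-trans (ℕ.m≤m+n c d) (ℕ.≤-reflexive c+d≡N)) 1≤c 1≤d c+d≡N

clamp : (n : ℕ) → ℕ → Fin (suc n)
clamp n       zero    = zero
clamp zero    (suc _) = zero
clamp (suc n) (suc t) = suc (clamp n t)

clamp-toℕ : ∀ n (i : Fin (suc n)) → clamp n (toℕ i) ≡ i
clamp-toℕ n       zero    = refl
clamp-toℕ (suc n) (suc i) = cong suc (clamp-toℕ n i)

clamp-last : ∀ n → clamp n n ≡ fromℕ n
clamp-last zero    = refl
clamp-last (suc n) = cong suc (clamp-last n)

clamp-inject₁ : ∀ n {t} → t ≤ n → clamp (suc n) t ≡ inject₁ (clamp n t)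
clamp-inject₁ n       {zero}  _         = refl
clamp-inject₁ (suc n) {suc t} (s≤s t≤n) = cong suc (clamp-inject₁ n t≤n)

clamp-cycPred : ∀ n {t} → t < n → cycPred (clamp n (suc t)) ≡ clamp n t
clamp-cycPred (suc n) (s≤s t≤n) = sym (clamp-inject₁ n t≤n)

-- column B t is m_t; clamp only serves to make it total in t.
column : ∀ {n} → Mat (suc n) → ℕ → ℤ
column {n} B t = B (clamp n t) zero

column-suc : ∀ {n} (B : Mat (suc n)) (j : Fin n) → column B (suc (toℕ j)) ≡ B (suc j) zero
column-suc {n} B j = cong (λ i → B i zero) (clamp-toℕ n (suc j))

clamp-suc≢zero : ∀ {n t} → t < n → clamp n (suc t) ≢ zero
clamp-suc≢zero {suc n} _ ()

mutate-zero-off : ∀ {N} (B : Mat (suc N)) {i j} → i ≢ zero → j ≢ zero →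
                  mutate B zero i j ≡ B i j +ℤ fzTerm (B i zero) (B zero j)
mutate-zero-off B {zero}  i≢0 _   = ⊥-elim (i≢0 refl)
mutate-zero-off B {suc i} {zero}  _ j≢0 = ⊥-elim (j≢0 refl)
mutate-zero-off B {suc i} {suc j} _ _   = ℤ.+-assoc (B (suc i) (suc j)) _ _

mutate-zeroʳ : ∀ {N} (B : Mat (suc N)) i → mutate B zero i zero ≡ - B i zero
mutate-zeroʳ B zero    = refl
mutate-zeroʳ B (suc i) = refl

module _ {n : ℕ} {B : Mat (suc n)} (skew : SkewSym B) (period1 : Period1 B) where

  private
    b : ℕ → ℕ → ℤ
    b i j = B (clamp n i) (clamp n j)

  period1-shift : ∀ {i j} → i < n → j < n → b i j ≡ b (suc i) (suc j) +ℤ fzTerm (b (suc i) 0) (- b (suc j) 0)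
  period1-shift {i} {j} i<n j<n = begin
    b i j                                    ≡⟨ cong₂ B (clamp-cycPred n i<n) (clamp-cycPred n j<n) ⟨
    rhoConj B (clamp n (suc i)) (clamp n (suc j))  ≡⟨ period1 (clamp n (suc i)) (clamp n (suc j)) ⟨
    mutate B zero (clamp n (suc i)) (clamp n (suc j)) ≡⟨ mutate-zero-off B (clamp-suc≢zero i<n) (clamp-suc≢zero j<n) ⟩
    b (suc i) (suc j) +ℤ fzTerm (b (suc i) 0) (B zero (clamp n (suc j))) ≡⟨ cong (λ x → b (suc i) (suc j) +ℤ fzTerm (b (suc i) 0) x) (skew _ _) ⟩
    b (suc i) (suc j) +ℤ fzTerm (b (suc i) 0) (- b (suc j) 0) ∎
    where open ≡-Reasoning

  period1-lastRow : ∀ {j} → j < n → b n j ≡ b (suc j) 0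
  period1-lastRow {j} j<n = begin
    b n j                                  ≡⟨ cong₂ B (clamp-last n) (sym (clamp-cycPred n j<n)) ⟩
    rhoConj B zero (clamp n (suc j))       ≡⟨ period1 zero (clamp n (suc j)) ⟨
    - B zero (clamp n (suc j))             ≡⟨ cong -_ (skew _ _) ⟩
    - - b (suc j) 0                        ≡⟨ ℤ.neg-involutive _ ⟩
    b (suc j) 0                            ∎
    where open ≡-Reasoning

  column-palindromic : ∀ c d → 1 ≤ c → 1 ≤ d → c +ℕ d ≡ suc n → column B c ≡ column B d
  column-palindromic = ShiftPalindrome.palindromic n b period1-shift period1-lastRow

-- Frozen rows

fzTerm-pos : ∀ a y → fzTerm (+ suc a) y ≡ + suc a *ℤ + pos y
fzTerm-pos a y = drop (+ suc a *ℤ + pos y) (+ pos (- y))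
  where
  drop : ∀ x z → x -ℤ + 0 *ℤ z ≡ x
  drop = solve-∀

fzTerm-neg : ∀ a y → fzTerm -[1+ a ] (- y) ≡ -[1+ a ] *ℤ + pos y
fzTerm-neg a y rewrite ℤ.neg-involutive y = drop (+ suc a) (+ pos y) (+ pos (- - y))
  where
  drop : ∀ a x z → + 0 *ℤ z -ℤ a *ℤ x ≡ (- a) *ℤ x
  drop = solve-∀

pos-split : ∀ a → a ≡ + pos a -ℤ + pos (- a)
pos-split (+ zero)  = refl
pos-split (+ suc a) = sym (ℤ.+-identityʳ (+ suc a))
pos-split -[1+ a ]  = refl

telescope : ∀ {n} {c : ℕ → ℤ} a e → (∀ {k} → k < n → c k ≡ c (suc k) +ℤ a *ℤ + e (suc k)) →
            ∀ {k} → k ≤ n → c 0 ≡ c k +ℤ a *ℤ + sumTo e k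
telescope {c = c} a e step {zero}  _     = sym (trans (cong (c 0 +ℤ_) (ℤ.*-zeroʳ a)) (ℤ.+-identityʳ (c 0)))
telescope {c = c} a e step {suc k} 1+k≤n = begin
  c 0                                                 ≡⟨ telescope a e step (ℕ.<⇒≤ 1+k≤n) ⟩
  c k +ℤ a *ℤ + sumTo e k                             ≡⟨ cong (_+ℤ a *ℤ + sumTo e k) (step 1+k≤n) ⟩
  (c (suc k) +ℤ a *ℤ + e (suc k)) +ℤ a *ℤ + sumTo e k ≡⟨ collect (c (suc k)) a (+ e (suc k)) (+ sumTo e k) ⟩
  c (suc k) +ℤ a *ℤ (+ sumTo e k +ℤ + e (suc k))      ≡⟨ cong (λ s → c (suc k) +ℤ a *ℤ s) (ℤ.pos-+ (sumTo e k) (e (suc k))) ⟨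
  c (suc k) +ℤ a *ℤ + sumTo e (suc k)                 ∎
  where
  open ≡-Reasoning
  collect : ∀ x a y s → (x +ℤ a *ℤ y) +ℤ a *ℤ s ≡ x +ℤ a *ℤ (s +ℤ y)
  collect = solve-∀

-- c 0 = c n + a Σe = -a + a Σe
antiperiodic-sum≡2 : ∀ {n} {c : ℕ → ℤ} a .{{_ : NonZero a}} e →
  (∀ {k} → k < n → c k ≡ c (suc k) +ℤ a *ℤ + e (suc k)) → c 0 ≡ a → c n ≡ - c 0 → sumTo e n ≡ 2
antiperiodic-sum≡2 {n} {c} a e step c0≡a cn≡-c0 = ℤ.+-injective (ℤ.*-cancelˡ-≡ a _ _ (begin
  a *ℤ + sumTo e n               ≡⟨ isolate a _ ⟨
  (- a +ℤ a *ℤ + sumTo e n) +ℤ a ≡⟨ cong (λ x → (x +ℤ a *ℤ + sumTo e n) +ℤ a) (trans (cong -_ (sym c0≡a)) (sym cn≡-c0)) ⟩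
  (c n +ℤ a *ℤ + sumTo e n) +ℤ a ≡⟨ cong (_+ℤ a) (telescope a e step ℕ.≤-refl) ⟨
  c 0 +ℤ a                       ≡⟨ cong (_+ℤ a) c0≡a ⟩
  a +ℤ a                         ≡⟨ double a ⟩
  a *ℤ + 2                       ∎))
  where
  open ≡-Reasoning
  isolate : ∀ a x → (- a +ℤ x) +ℤ a ≡ x
  isolate = solve-∀
  double : ∀ a → a +ℤ a ≡ a *ℤ + 2
  double = solve-∀

positivePart negativePart : (ℕ → ℤ) → ℕ → ℕ
positivePart m t = pos (m t)
negativePart m t = pos (- m t)

-- The constraints that periodicity of an ice quiver puts on a frozen row c (c k is its entry
-- at mutable vertex k) when the mutable part has first column m.
record FrozenRow (n : ℕ) (m : ℕ → ℤ) (c : ℕ → ℤ) : Set where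
  field
    shift        : ∀ {k} → k < n → c k ≡ c (suc k) +ℤ fzTerm (c 0) (- m (suc k))
    antiperiodic : c n ≡ - c 0

module _ {n : ℕ} {m : ℕ → ℤ} {c : ℕ → ℤ} (row : FrozenRow n m c) where
  open FrozenRow row

  frozenRow-positive : ∀ {a} → c 0 ≡ + suc a → sumTo (negativePart m) n ≡ 2
  frozenRow-positive {a} c0≡a = antiperiodic-sum≡2 (+ suc a) (negativePart m) step c0≡a antiperiodic
    where
    step : ∀ {k} → k < n → c k ≡ c (suc k) +ℤ + suc a *ℤ + negativePart m (suc k)
    step {k} k<n = trans (shift k<n) (cong (c (suc k) +ℤ_) (trans (cong (λ x → fzTerm x (- m (suc k))) c0≡a) (fzTerm-pos a (- m (suc k)))))

  frozenRow-negative : ∀ {a} → c 0 ≡ -[1+ a ] → sumTo (positivePart m) n ≡ 2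
  frozenRow-negative {a} c0≡a = antiperiodic-sum≡2 -[1+ a ] (positivePart m) step c0≡a antiperiodic
    where
    step : ∀ {k} → k < n → c k ≡ c (suc k) +ℤ -[1+ a ] *ℤ + positivePart m (suc k)
    step {k} k<n = trans (shift k<n) (cong (c (suc k) +ℤ_) (trans (cong (λ x → fzTerm x (- m (suc k))) c0≡a) (fzTerm-neg a (m (suc k)))))

module _ (m : ℕ → ℤ) where

  frozenRow : ℤ → ℕ → ℤ
  frozenRow a k = a -ℤ + pos a *ℤ + sumTo (negativePart m) k +ℤ + pos (- a) *ℤ + sumTo (positivePart m) k

  frozenRow-zero : ∀ a → frozenRow a 0 ≡ a
  frozenRow-zero a = vanish a (+ pos a) (+ pos (- a))
    where
    vanish : ∀ a p q → a -ℤ p *ℤ + 0 +ℤ q *ℤ + 0 ≡ a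
    vanish = solve-∀

  frozenRow-shift : ∀ a {k} → frozenRow a k ≡ frozenRow a (suc k) +ℤ fzTerm (frozenRow a 0) (- m (suc k))
  frozenRow-shift a {k} rewrite frozenRow-zero a
                              | ℤ.pos-+ (sumTo (negativePart m) k) (negativePart m (suc k))
                              | ℤ.pos-+ (sumTo (positivePart m) k) (positivePart m (suc k))
                              | ℤ.neg-involutive (m (suc k)) =
    regroup a (+ pos a) (+ pos (- a)) (+ sumTo (negativePart m) k) (+ sumTo (positivePart m) k)
            (+ negativePart m (suc k)) (+ positivePart m (suc k))
    where
    regroup : ∀ a p q sn sp en ep →
      a -ℤ p *ℤ sn +ℤ q *ℤ sp ≡ (a -ℤ p *ℤ (sn +ℤ en) +ℤ q *ℤ (sp +ℤ ep)) +ℤ (p *ℤ en -ℤ q *ℤ ep)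
    regroup = solve-∀

  frozenRow-frozenRow : ∀ {n} → sumTo (positivePart m) n ≡ 2 → sumTo (negativePart m) n ≡ 2 →
                        ∀ a → FrozenRow n m (frozenRow a)
  frozenRow-frozenRow {n} Σp≡2 Σn≡2 a = record
    { shift        = λ _ → frozenRow-shift a
    ; antiperiodic = begin
        frozenRow a n                                 ≡⟨ cong₂ (λ sn sp → a -ℤ + pos a *ℤ + sn +ℤ + pos (- a) *ℤ + sp) Σn≡2 Σp≡2 ⟩
        a -ℤ + pos a *ℤ + 2 +ℤ + pos (- a) *ℤ + 2     ≡⟨ cong (λ x → x -ℤ + pos a *ℤ + 2 +ℤ + pos (- a) *ℤ + 2) (pos-split a) ⟩
        (+ pos a -ℤ + pos (- a)) -ℤ + pos a *ℤ + 2 +ℤ + pos (- a) *ℤ + 2 ≡⟨ reflect (+ pos a) (+ pos (- a)) ⟩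
        - (+ pos a -ℤ + pos (- a))                    ≡⟨ cong -_ (pos-split a) ⟨
        - a                                           ≡⟨ cong -_ (frozenRow-zero a) ⟨
        - frozenRow a 0                               ∎
    }
    where
    open ≡-Reasoning
    reflect : ∀ p q → (p -ℤ q) -ℤ p *ℤ + 2 +ℤ q *ℤ + 2 ≡ - (p -ℤ q)
    reflect = solve-∀

pos≢0⇒positive : ∀ a → pos a ≢ 0 → ∃[ a′ ] a ≡ + suc a′
pos≢0⇒positive (+ zero)  pa≢0 = ⊥-elim (pa≢0 refl)
pos≢0⇒positive (+ suc a) _    = a , refl
pos≢0⇒positive -[1+ a ]  pa≢0 = ⊥-elim (pa≢0 refl)

pos-neg≢0⇒negative : ∀ a → pos (- a) ≢ 0 → ∃[ a′ ] a ≡ -[1+ a′ ]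
pos-neg≢0⇒negative (+ zero)  p≢0 = ⊥-elim (p≢0 refl)
pos-neg≢0⇒negative (+ suc a) p≢0 = ⊥-elim (p≢0 refl)
pos-neg≢0⇒negative -[1+ a ]  _   = a , refl

-- Period 1 ice quivers

mutate-skew : ∀ {N} {B : Mat N} → SkewSym B → ∀ k → SkewSym (mutate B k)
mutate-skew {B = B} skew k i j with does (i ≟ᶠ k) | does (j ≟ᶠ k)
... | true  | true  = cong -_ (skew i j)
... | true  | false = cong -_ (skew i j)
... | false | true  = cong -_ (skew i j)
... | false | false rewrite skew i j | skew k j | skew i k | ℤ.neg-involutive (B k j) | ℤ.neg-involutive (B i k) =
  negate (B i j) (+ pos (B i k)) (+ pos (- B i k)) (+ pos (B k j)) (+ pos (- B k j))
  where
  negate : ∀ b p q p′ q′ → - b +ℤ q′ *ℤ q -ℤ p′ *ℤ p ≡ - (b +ℤ p *ℤ p′ -ℤ q *ℤ q′)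
  negate = solve-∀

mutateIce-skew : ∀ N {M} {B : Mat (N +ℕ M)} → SkewSym B → ∀ k → SkewSym (mutateIce N B k)
mutateIce-skew N skew k i j with isFrozen N i | isFrozen N j
... | true  | true  = refl
... | true  | false = mutate-skew skew k i j
... | false | true  = mutate-skew skew k i j
... | false | false = mutate-skew skew k i j

mutate-zero-↑ˡ : ∀ {n M} {Bt : Mat (suc n +ℕ M)} {B : Mat (suc n)} → Extends Bt B →
                 ∀ i j → mutate Bt zero (i ↑ˡ M) (j ↑ˡ M) ≡ mutate B zero i j
mutate-zero-↑ˡ ext zero    j       = cong -_ (ext zero j)
mutate-zero-↑ˡ ext (suc i) zero    = cong -_ (ext (suc i) zero)
mutate-zero-↑ˡ {Bt = Bt} {B} ext (suc i) (suc j) = begin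
  mutate Bt zero (suc i ↑ˡ _) (suc j ↑ˡ _)    ≡⟨ mutate-zero-off Bt (λ ()) (λ ()) ⟩
  Bt (suc i ↑ˡ _) (suc j ↑ˡ _) +ℤ fzTerm (Bt (suc i ↑ˡ _) zero) (Bt zero (suc j ↑ˡ _))
    ≡⟨ cong₂ _+ℤ_ (ext (suc i) (suc j)) (cong₂ fzTerm (ext (suc i) zero) (ext zero (suc j))) ⟩
  B (suc i) (suc j) +ℤ fzTerm (B (suc i) zero) (B zero (suc j)) ≡⟨ mutate-zero-off B (λ ()) (λ ()) ⟨
  mutate B zero (suc i) (suc j)               ∎
  where open ≡-Reasoning

isFrozen-↑ˡ : ∀ N M (i : Fin N) → isFrozen N {M} (i ↑ˡ M) ≡ false
isFrozen-↑ˡ N M i rewrite Fin.splitAt-↑ˡ N i M = refl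

isFrozen-↑ʳ : ∀ N M (f : Fin M) → isFrozen N {M} (N ↑ʳ f) ≡ true
isFrozen-↑ʳ N M f rewrite Fin.splitAt-↑ʳ N M f = refl

rhoTildeInv-↑ˡ : ∀ n M (i : Fin (suc n)) → rhoTildeInv n M (i ↑ˡ M) ≡ cycPred i ↑ˡ M
rhoTildeInv-↑ˡ n M i rewrite Fin.splitAt-↑ˡ (suc n) i M = refl

rhoTildeInv-↑ʳ : ∀ n M (f : Fin M) → rhoTildeInv n M (suc n ↑ʳ f) ≡ suc n ↑ʳ f
rhoTildeInv-↑ʳ n M f rewrite Fin.splitAt-↑ʳ (suc n) M f = refl

mutateIce-unfrozenʳ : ∀ N {M} (B : Mat (N +ℕ M)) k i j → isFrozen N j ≡ false → mutateIce N B k i j ≡ mutate B k i j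
mutateIce-unfrozenʳ N B k i j j-unfrozen rewrite j-unfrozen | Data.Bool.Properties.∧-zeroʳ (isFrozen N i) = refl

mutateIce-frozen : ∀ N {M} (B : Mat (N +ℕ M)) k i j → isFrozen N i ≡ true → isFrozen N j ≡ true → mutateIce N B k i j ≡ + 0
mutateIce-frozen N B k i j i-frozen j-frozen rewrite i-frozen | j-frozen = refl

module _ {n M : ℕ} {Bt : Mat (suc n +ℕ M)} {B : Mat (suc n)}
         (ice : IsPeriod1IceQuiver n M Bt) (ext : Extends Bt B) (skew : SkewSym B) where

  iceRow : Fin M → ℕ → ℤ
  iceRow f k = Bt (suc n ↑ʳ f) (clamp n k ↑ˡ M)

  private
    period : ∀ f (i : Fin (suc n)) → Bt (suc n ↑ʳ f) (cycPred i ↑ˡ M) ≡ mutate Bt zero (suc n ↑ʳ f) (i ↑ˡ M)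
    period f i = begin
      Bt (suc n ↑ʳ f) (cycPred i ↑ˡ M)                          ≡⟨ cong₂ Bt (rhoTildeInv-↑ʳ n M f) (rhoTildeInv-↑ˡ n M i) ⟨
      conj (rhoTildeInv n M) Bt (suc n ↑ʳ f) (i ↑ˡ M)           ≡⟨ proj₂ (proj₂ ice) (suc n ↑ʳ f) (i ↑ˡ M) ⟨
      mutateIce (suc n) Bt zero (suc n ↑ʳ f) (i ↑ˡ M)           ≡⟨ mutateIce-unfrozenʳ (suc n) Bt zero _ _ (isFrozen-↑ˡ (suc n) M i) ⟩
      mutate Bt zero (suc n ↑ʳ f) (i ↑ˡ M)                      ∎
      where open ≡-Reasoning

  iceRow-frozenRow : ∀ f → FrozenRow n (column B) (iceRow f)
  iceRow-frozenRow f = record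
    { shift = λ {k} k<n → let i = clamp n (suc k) in begin
        iceRow f k                                              ≡⟨ cong (λ j → Bt (suc n ↑ʳ f) (j ↑ˡ M)) (clamp-cycPred n k<n) ⟨
        Bt (suc n ↑ʳ f) (cycPred i ↑ˡ M)                        ≡⟨ period f i ⟩
        mutate Bt zero (suc n ↑ʳ f) (i ↑ˡ M)                    ≡⟨ mutate-zero-off Bt (λ ()) (clamp-suc≢zero k<n ∘′ Fin.↑ˡ-injective M i zero) ⟩
        iceRow f (suc k) +ℤ fzTerm (iceRow f 0) (Bt zero (i ↑ˡ M)) ≡⟨ cong (λ x → iceRow f (suc k) +ℤ fzTerm (iceRow f 0) x) (trans (ext zero i) (skew i zero)) ⟩
        iceRow f (suc k) +ℤ fzTerm (iceRow f 0) (- column B (suc k)) ∎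
    ; antiperiodic = begin
        iceRow f n                                              ≡⟨ cong (λ j → Bt (suc n ↑ʳ f) (j ↑ˡ M)) (clamp-last n) ⟩
        Bt (suc n ↑ʳ f) (cycPred zero ↑ˡ M)                     ≡⟨ period f zero ⟩
        mutate Bt zero (suc n ↑ʳ f) zero                        ≡⟨ mutate-zeroʳ Bt (suc n ↑ʳ f) ⟩
        - iceRow f 0                                            ∎
    }
    where open ≡-Reasoning

module IceExtension {n M : ℕ} (B : Mat (suc n)) (rows : Fin M → ℕ → ℤ) where

  block : Fin (suc n) ⊎ Fin M → Fin (suc n) ⊎ Fin M → ℤ
  block (inj₁ i) (inj₁ j) = B i j
  block (inj₁ i) (inj₂ f) = - rows f (toℕ i)
  block (inj₂ f) (inj₁ j) = rows f (toℕ j)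
  block (inj₂ _) (inj₂ _) = + 0

  extension : Mat (suc n +ℕ M)
  extension x y = block (splitAt (suc n) x) (splitAt (suc n) y)

  extension-join : ∀ u v → extension (join (suc n) M u) (join (suc n) M v) ≡ block u v
  extension-join u v = cong₂ block (Fin.splitAt-join (suc n) M u) (Fin.splitAt-join (suc n) M v)

  extension-extends : Extends extension B
  extension-extends i j = extension-join (inj₁ i) (inj₁ j)

  extension-skew : SkewSym B → SkewSym extension
  extension-skew skew x y = skewBlock (splitAt (suc n) x) (splitAt (suc n) y)
    where
    skewBlock : ∀ u v → block v u ≡ - block u v
    skewBlock (inj₁ i) (inj₁ j) = skew i j
    skewBlock (inj₁ i) (inj₂ f) = sym (ℤ.neg-involutive _)
    skewBlock (inj₂ f) (inj₁ j) = refl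
    skewBlock (inj₂ f) (inj₂ g) = refl

  module _ (skew : SkewSym B) (period1 : Period1 B) (frozen : ∀ f → FrozenRow n (column B) (rows f)) where

    private
      Bt = extension
      F : Fin M → Fin (suc n +ℕ M)
      F f = suc n ↑ʳ f

      Periodic : Fin (suc n +ℕ M) → Fin (suc n +ℕ M) → Set
      Periodic x y = mutateIce (suc n) Bt zero x y ≡ conj (rhoTildeInv n M) Bt x y

      periodic-swap : ∀ x y → Periodic x y → Periodic y x
      periodic-swap x y per = begin
        mutateIce (suc n) Bt zero y x    ≡⟨ mutateIce-skew (suc n) (extension-skew skew) zero x y ⟩
        - mutateIce (suc n) Bt zero x y  ≡⟨ cong -_ per ⟩
        - conj (rhoTildeInv n M) Bt x y  ≡⟨ extension-skew skew (rhoTildeInv n M x) (rhoTildeInv n M y) ⟨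
        conj (rhoTildeInv n M) Bt y x    ∎
        where open ≡-Reasoning

      periodic-mutable : ∀ i j → Periodic (i ↑ˡ M) (j ↑ˡ M)
      periodic-mutable i j = begin
        mutateIce (suc n) Bt zero (i ↑ˡ M) (j ↑ˡ M) ≡⟨ mutateIce-unfrozenʳ (suc n) Bt zero (i ↑ˡ M) (j ↑ˡ M) (isFrozen-↑ˡ (suc n) M j) ⟩
        mutate Bt zero (i ↑ˡ M) (j ↑ˡ M)           ≡⟨ mutate-zero-↑ˡ {Bt = Bt} extension-extends i j ⟩
        mutate B zero i j                          ≡⟨ period1 i j ⟩
        B (cycPred i) (cycPred j)                  ≡⟨ extension-extends (cycPred i) (cycPred j) ⟨
        Bt (cycPred i ↑ˡ M) (cycPred j ↑ˡ M)       ≡⟨ cong₂ Bt (rhoTildeInv-↑ˡ n M i) (rhoTildeInv-↑ˡ n M j) ⟨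
        conj (rhoTildeInv n M) Bt (i ↑ˡ M) (j ↑ˡ M) ∎
        where open ≡-Reasoning

      periodic-frozen² : ∀ f g → Periodic (F f) (F g)
      periodic-frozen² f g = begin
        mutateIce (suc n) Bt zero (F f) (F g)       ≡⟨ mutateIce-frozen (suc n) Bt zero (F f) (F g) (isFrozen-↑ʳ (suc n) M f) (isFrozen-↑ʳ (suc n) M g) ⟩
        + 0                                         ≡⟨ extension-join (inj₂ f) (inj₂ g) ⟨
        Bt (F f) (F g)                              ≡⟨ cong₂ Bt (rhoTildeInv-↑ʳ n M f) (rhoTildeInv-↑ʳ n M g) ⟨
        conj (rhoTildeInv n M) Bt (F f) (F g)       ∎
        where open ≡-Reasoning
      periodic-frozen : ∀ f j → Periodic (F f) (j ↑ˡ M)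
      periodic-frozen f zero = begin
        mutateIce (suc n) Bt zero (F f) zero          ≡⟨ mutateIce-unfrozenʳ (suc n) Bt zero (F f) zero (isFrozen-↑ˡ (suc n) M zero) ⟩
        mutate Bt zero (F f) zero                     ≡⟨ mutate-zeroʳ Bt (F f) ⟩
        - Bt (F f) zero                               ≡⟨ cong -_ (extension-join (inj₂ f) (inj₁ zero)) ⟩
        - rows f 0                                    ≡⟨ FrozenRow.antiperiodic (frozen f) ⟨
        rows f n                                      ≡⟨ cong (rows f) (Fin.toℕ-fromℕ n) ⟨
        rows f (toℕ (fromℕ n))                        ≡⟨ extension-join (inj₂ f) (inj₁ (fromℕ n)) ⟨
        Bt (F f) (fromℕ n ↑ˡ M)                       ≡⟨ cong₂ Bt (rhoTildeInv-↑ʳ n M f) (rhoTildeInv-↑ˡ n M zero) ⟨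
        conj (rhoTildeInv n M) Bt (F f) zero          ∎
        where open ≡-Reasoning
      periodic-frozen f (suc y) = begin
        mutateIce (suc n) Bt zero (F f) (suc y ↑ˡ M)  ≡⟨ mutateIce-unfrozenʳ (suc n) Bt zero (F f) (suc y ↑ˡ M) (isFrozen-↑ˡ (suc n) M (suc y)) ⟩
        mutate Bt zero (F f) (suc y ↑ˡ M)             ≡⟨ mutate-zero-off Bt {F f} {suc y ↑ˡ M} (λ ()) (λ ()) ⟩
        Bt (F f) (suc y ↑ˡ M) +ℤ fzTerm (Bt (F f) zero) (Bt zero (suc y ↑ˡ M))
          ≡⟨ cong₂ _+ℤ_ (extension-join (inj₂ f) (inj₁ (suc y)))
                   (cong₂ fzTerm (extension-join (inj₂ f) (inj₁ zero)) (extension-join (inj₁ zero) (inj₁ (suc y)))) ⟩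
        rows f (suc (toℕ y)) +ℤ fzTerm (rows f 0) (B zero (suc y))
          ≡⟨ cong (λ z → rows f (suc (toℕ y)) +ℤ fzTerm (rows f 0) z) (trans (skew (suc y) zero) (cong -_ (sym (column-suc B y)))) ⟩
        rows f (suc (toℕ y)) +ℤ fzTerm (rows f 0) (- column B (suc (toℕ y))) ≡⟨ FrozenRow.shift (frozen f) (Fin.toℕ<n y) ⟨
        rows f (toℕ y)                                ≡⟨ cong (rows f) (Fin.toℕ-inject₁ y) ⟨
        rows f (toℕ (inject₁ y))                      ≡⟨ extension-join (inj₂ f) (inj₁ (inject₁ y)) ⟨
        Bt (F f) (inject₁ y ↑ˡ M)                     ≡⟨ cong₂ Bt (rhoTildeInv-↑ʳ n M f) (rhoTildeInv-↑ˡ n M (suc y)) ⟨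
        conj (rhoTildeInv n M) Bt (F f) (suc y ↑ˡ M)  ∎
        where open ≡-Reasoning

      periodic-block : ∀ u v → Periodic (join (suc n) M u) (join (suc n) M v)
      periodic-block (inj₁ i) (inj₁ j) = periodic-mutable i j
      periodic-block (inj₂ f) (inj₂ g) = periodic-frozen² f g
      periodic-block (inj₂ f) (inj₁ j) = periodic-frozen f j
      periodic-block (inj₁ i) (inj₂ f) = periodic-swap (F f) (i ↑ˡ M) (periodic-frozen f i)

    extension-period1 : IsPeriod1IceQuiver n M extension
    extension-period1 = extension-skew skew , (λ f g → extension-join (inj₂ f) (inj₂ g)) , periodic
      where
      periodic : ∀ x y → Periodic x y
      periodic x y = subst₂ Periodic (Fin.join-splitAt (suc n) M x) (Fin.join-splitAt (suc n) M y)
                       (periodic-block (splitAt (suc n) x) (splitAt (suc n) y))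

module _ {n M : ℕ} {Bt : Mat (suc n +ℕ M)} {B : Mat (suc n)}
         (ice : IsPeriod1IceQuiver n M Bt) (ext : Extends Bt B) (skew : SkewSym B) where

  nontrivial-u⇒sum-negativePart≡2 : ¬ IsOne (uExp {n} {M} Bt) → sumTo (negativePart (column B)) n ≡ 2
  nontrivial-u⇒sum-negativePart≡2 u≢1
    with Fin.¬∀⟶∃¬ M (λ f → uExp {n} {M} Bt f ≡ 0) (λ f → uExp {n} {M} Bt f ≟ 0) u≢1
  ... | f , uf≢0 with pos≢0⇒positive (Bt (suc n ↑ʳ f) zero) uf≢0
  ...   | _ , head≡a = frozenRow-positive (iceRow-frozenRow ice ext skew f) head≡a

  nontrivial-v⇒sum-positivePart≡2 : ¬ IsOne (vExp {n} {M} Bt) → sumTo (positivePart (column B)) n ≡ 2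
  nontrivial-v⇒sum-positivePart≡2 v≢1
    with Fin.¬∀⟶∃¬ M (λ f → vExp {n} {M} Bt f ≡ 0) (λ f → vExp {n} {M} Bt f ≟ 0) v≢1
  ... | f , vf≢0 with pos-neg≢0⇒negative (Bt (suc n ↑ʳ f) zero) vf≢0
  ...   | _ , head≡a = frozenRow-negative (iceRow-frozenRow ice ext skew f) head≡a

galeRobinson⇔GRmon : ∀ {n r} {e : ℕ → ℕ} →
  (∀ t → InRange n t → e t ≡ grExp n r t) ⇔ (∀ (j : Fin n) → e (suc (toℕ j)) ≡ GRmon n r j)
galeRobinson⇔GRmon {n} {r} {e} = mk⇔ (λ onRange j → onRange (suc (toℕ j)) (s≤s z≤n , Fin.toℕ<n j)) onFin
  where
  onFin : (∀ (j : Fin n) → e (suc (toℕ j)) ≡ GRmon n r j) → ∀ t → InRange n t → e t ≡ grExp n r t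
  onFin onFin (suc t) (_ , 1+t≤n) = subst (λ x → e (suc x) ≡ grExp n r (suc x)) (Fin.toℕ-fromℕ< 1+t≤n) (onFin (fromℕ< 1+t≤n))

module _ {n : ℕ} (B : Mat (suc n)) where

  Pplus-positivePart : ∀ j → Pplus B j ≡ positivePart (column B) (suc (toℕ j))
  Pplus-positivePart j = cong pos (sym (column-suc B j))

  Pminus-negativePart : ∀ j → Pminus B j ≡ negativePart (column B) (suc (toℕ j))
  Pminus-negativePart j = cong (λ x → pos (- x)) (sym (column-suc B j))

  GaleRobinsonRecurrence : Set
  GaleRobinsonRecurrence = ∃[ r ] ∃[ s ] (0 < r × r < s × 2 * s ≤ suc n
    × (((∀ j → Pplus B j ≡ GRmon n r j) × (∀ j → Pminus B j ≡ GRmon n s j)) ⊎ ((∀ j → Pplus B j ≡ GRmon n s j) × (∀ j → Pminus B j ≡ GRmon n r j))))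

  private
    Σ⁺≡2 Σ⁻≡2 : Set
    Σ⁺≡2 = sumTo (positivePart (column B)) n ≡ 2
    Σ⁻≡2 = sumTo (negativePart (column B)) n ≡ 2

    sumTo-positivePart : ∀ {x} → 1 ≤ x → x +ℕ x ≤ suc n → (∀ j → Pplus B j ≡ GRmon n x j) → Σ⁺≡2
    sumTo-positivePart 1≤x 2x≤N P≡GR = trans
      (sumTo-cong n (Equivalence.from galeRobinson⇔GRmon (λ j → trans (sym (Pplus-positivePart j)) (P≡GR j))))
      (sumTo-grExp n 1≤x 2x≤N)

    sumTo-negativePart : ∀ {x} → 1 ≤ x → x +ℕ x ≤ suc n → (∀ j → Pminus B j ≡ GRmon n x j) → Σ⁻≡2
    sumTo-negativePart 1≤x 2x≤N P≡GR = trans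
      (sumTo-cong n (Equivalence.from galeRobinson⇔GRmon (λ j → trans (sym (Pminus-negativePart j)) (P≡GR j))))
      (sumTo-grExp n 1≤x 2x≤N)

    double≡2* : ∀ s → s +ℕ s ≡ 2 * s
    double≡2* s = cong (s +ℕ_) (sym (ℕ.+-identityʳ s))

  galeRobinson⇒sums≡2 : GaleRobinsonRecurrence → Σ⁺≡2 × Σ⁻≡2
  galeRobinson⇒sums≡2 (r , s , 1≤r , r<s , 2*s≤N , orientation) =
    [ (λ (P≡r , N≡s) → sumTo-positivePart 1≤r 2r≤N P≡r , sumTo-negativePart 1≤s 2s≤N N≡s)
    , (λ (P≡s , N≡r) → sumTo-positivePart 1≤s 2s≤N P≡s , sumTo-negativePart 1≤r 2r≤N N≡r)
    ]′ orientation
    where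
    1≤s : 1 ≤ s
    1≤s = ℕ.<-trans 1≤r r<s
    2s≤N : s +ℕ s ≤ suc n
    2s≤N = subst (_≤ suc n) (sym (double≡2* s)) 2*s≤N
    2r≤N : r +ℕ r ≤ suc n
    2r≤N = ℕ.≤-trans (ℕ.+-mono-≤ (ℕ.<⇒≤ r<s) (ℕ.<⇒≤ r<s)) 2s≤N

  module _ (skew : SkewSym B) (period1 : Period1 B) where

    private
      palindromic⁺ : Palindromic n (positivePart (column B))
      palindromic⁺ c d 1≤c 1≤d c+d≡N = cong pos (column-palindromic skew period1 c d 1≤c 1≤d c+d≡N)

      palindromic⁻ : Palindromic n (negativePart (column B))
      palindromic⁻ c d 1≤c 1≤d c+d≡N = cong (λ x → pos (- x)) (column-palindromic skew period1 c d 1≤c 1≤d c+d≡N)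

      grExp-self : ∀ r → 1 ≤ grExp n r r
      grExp-self r = ℕ.≤-trans (ℕ.≤-reflexive (sym (δ-refl r))) (ℕ.m≤m+n _ _)

      pos-and-neg : ∀ x → 1 ≤ pos x → 1 ≤ pos (- x) → ⊥
      pos-and-neg (+ zero)  ()
      pos-and-neg (+ suc _) _ ()
      pos-and-neg -[1+ _ ]  ()

      Pplus≡GRmon : ∀ {r} → GaleRobinson n r (positivePart (column B)) → ∀ j → Pplus B j ≡ GRmon n r j
      Pplus≡GRmon (_ , _ , onRange) j = trans (Pplus-positivePart j) (Equivalence.to galeRobinson⇔GRmon onRange j)

      Pminus≡GRmon : ∀ {s} → GaleRobinson n s (negativePart (column B)) → ∀ j → Pminus B j ≡ GRmon n s j
      Pminus≡GRmon (_ , _ , onRange) j = trans (Pminus-negativePart j) (Equivalence.to galeRobinson⇔GRmon onRange j)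

    sums≡2⇒galeRobinson : Σ⁺≡2 → Σ⁻≡2 → GaleRobinsonRecurrence
    sums≡2⇒galeRobinson Σ⁺ Σ⁻
      with palindromic-galeRobinson palindromic⁺ Σ⁺ | palindromic-galeRobinson palindromic⁻ Σ⁻
    ... | r , GR⁺@(1≤r , 2r≤N , onRange⁺) | s , GR⁻@(1≤s , 2s≤N , onRange⁻) with ℕ.<-cmp r s
    ...   | tri< r<s _ _ = r , s , 1≤r , r<s , subst (_≤ suc n) (double≡2* s) 2s≤N , inj₁ (Pplus≡GRmon GR⁺ , Pminus≡GRmon GR⁻)
    ...   | tri> _ _ s<r = s , r , 1≤s , s<r , subst (_≤ suc n) (double≡2* r) 2r≤N , inj₂ (Pplus≡GRmon GR⁺ , Pminus≡GRmon GR⁻)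
    ...   | tri≈ _ refl _ = ⊥-elim (pos-and-neg (column B r)
                              (subst (1 ≤_) (sym (onRange⁺ r r∈)) (grExp-self r)) (subst (1 ≤_) (sym (onRange⁻ r r∈)) (grExp-self r)))
      where
      r∈ : InRange n r
      r∈ = 1≤r , double≤1+n⇒≤n 1≤r 2r≤N

    -- Two frozen vertices, with heads +1 and -1, carry the coefficients u and v.
    sums≡2⇒iceQuiver : Σ⁺≡2 → Σ⁻≡2 →
      ∃[ M ] ∃[ Bt ] (IsPeriod1IceQuiver n M Bt × Extends Bt B × ¬ IsOne (uExp {n} {M} Bt) × ¬ IsOne (vExp {n} {M} Bt))
    sums≡2⇒iceQuiver Σ⁺ Σ⁻ = 2 , extension , extension-period1 skew period1 frozen , extension-extends
                             , (λ isOne → ℕ.1+n≢0 (trans (sym (cong pos (head-at zero))) (isOne zero)))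
                             , (λ isOne → ℕ.1+n≢0 (trans (sym (cong (λ x → pos (- x)) (head-at (suc zero)))) (isOne (suc zero))))
      where
      head : Fin 2 → ℤ
      head zero       = + 1
      head (suc zero) = -[1+ 0 ]
      rows : Fin 2 → ℕ → ℤ
      rows f = frozenRow (column B) (head f)
      open IceExtension B rows
      frozen : ∀ f → FrozenRow n (column B) (rows f)
      frozen f = frozenRow-frozenRow (column B) Σ⁺ Σ⁻ (head f)
      head-at : ∀ f → extension (suc n ↑ʳ f) zero ≡ head f
      head-at f = trans (extension-join (inj₂ f) (inj₁ zero)) (frozenRow-zero (column B) (head f))

mainTheorem18 : (n : ℕ) (B : Mat (suc n)) → SkewSym B → Period1 B →
    (∃[ M ] ∃[ Bt ] (IsPeriod1IceQuiver n M Bt × Extends Bt B × ¬ IsOne (uExp {n} {M} Bt) × ¬ IsOne (vExp {n} {M} Bt)))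
    ⇔ (∃[ r ] ∃[ s ] (0 < r × r < s × 2 * s ≤ suc n
    × (((∀ j → Pplus B j ≡ GRmon n r j) × (∀ j → Pminus B j ≡ GRmon n s j)) ⊎ ((∀ j → Pplus B j ≡ GRmon n s j) × (∀ j → Pminus B j ≡ GRmon n r j)))))
mainTheorem18 n B skew period1 = mk⇔
  (λ (_ , _ , ice , ext , u≢1 , v≢1) →
     sums≡2⇒galeRobinson B skew period1 (nontrivial-v⇒sum-positivePart≡2 ice ext skew v≢1)
                                        (nontrivial-u⇒sum-negativePart≡2 ice ext skew u≢1))
  (λ galeRobinson → let Σ⁺ , Σ⁻ = galeRobinson⇒sums≡2 B galeRobinson in sums≡2⇒iceQuiver B skew period1 Σ⁺ Σ⁻)
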